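{- Let $s$ be a positive integer and $E,F$ finite subsets of $\mathbb{Z}^s$ with $\mathcal{O}(E)\subseteq F$. Suppose that $|F|\le s^2/4$. Then $|F|\ge (s/2)|E|$. Moreover, if $\mathbf{x}_1,\dots,\mathbf{x}_r$ denote the distinct elements of $E$, there is a partition $F=F_1\amalg\cdots\amalg F_r\amalg F_{r+1}$ of $F$ such that, for each $i=1,\dots,r$, $F_i\subseteq\mathcal{O}(\mathbf{x}_i)$ and $|F_i|\ge s/2$.
   Context: $(\mathbf{e}_1,\dots,\mathbf{e}_s)$ is the canonical basis of $\mathbb{Z}^s$. For $\mathbf{x}\in\mathbb{Z}^s$, $\mathcal{O}(\mathbf{x})=\{\mathbf{x}+\mathbf{e}_1,\dots,\mathbf{x}+\mathbf{e}_s\}$, and for $E\subseteq\mathbb{Z}^s$, $\mathcal{O}(E)=\bigcup_{\mathbf{x}\in E}\mathcal{O}(\mathbf{x})$. Parts of a partition may be empty. -}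

module Defs where

open import Data.Nat using (ℕ)
open import Data.Integer using (ℤ; +_; _+_)
open import Data.Fin using (Fin; _≟_)
open import Data.Vec using (Vec; tabulate; zipWith)
open import Data.Bool using (if_then_else_)
open import Data.Product using (∃)
open import Data.List using (List)
open import Data.List.Membership.Propositional using (_∈_)
open import Relation.Nullary.Decidable using (⌊_⌋)
open import Relation.Binary.PropositionalEquality using (_≡_)

Point : ℕ → Set
Point s = Vec ℤ s

unit : {s : ℕ} → Fin s → Point s
unit i = tabulate (λ j → if ⌊ i ≟ j ⌋ then + 1 else + 0)

_+ᵥ_ : {s : ℕ} → Point s → Point s → Point s
_+ᵥ_ = zipWith _+_

_∈𝒪_ : {s : ℕ} → Point s → Point s → Set
y ∈𝒪 x = ∃ λ i → y ≡ x +ᵥ unit i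

𝒪⊆ : {s : ℕ} → List (Point s) → List (Point s) → Set
𝒪⊆ {s} E F = ∀ x → x ∈ E → (i : Fin s) → (x +ᵥ unit i) ∈ F

-- Two distinct points of ℤ^s have at most one common successor, so 𝒪(x) meets
-- 𝒪(z₁) ∪ ⋯ ∪ 𝒪(zₖ) in at most k points when x ∉ {z₁, …, zₖ}. Serving the points
-- x₀, …, x_{r-1} of E in turn, each taking the points of F in its own 𝒪 that no earlier
-- point has taken, the part of xⱼ therefore has at least s − j points, and
-- |F| ≥ s + (s − 1) + ⋯ + (s − r + 1). If some 2j exceeded s, then at the first such j
-- (where s is 2j − 2 or 2j − 1) the first j terms of this sum would already exceed s²/4.
-- So 2j ≤ s for every j < r, each part has at least s − j ≥ s/2 points, and summing
-- gives |F| ≥ (s/2)|E|.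

module Submission where

open import Defs
open import Data.Nat using (ℕ; zero; suc; _≤_; _<_; _+_; _*_; _∸_; z≤n; s≤s; s≤s⁻¹; z<s; _≤?_)
open import Data.Nat.Properties
  using ( ≤-refl; ≤-reflexive; ≤-trans; ≤-antisym; <-trans; <⇒≤; <⇒≱; ≰⇒>; n<1+n; m≤m+n; m<m+n
        ; m≤n⇒m<n∨m≡n; +-identityʳ; +-suc; *-zeroʳ; *-suc; *-comm; *-distribˡ-+
        ; +-mono-≤; +-monoˡ-≤; +-monoʳ-≤; *-monoʳ-≤; ∸-monoʳ-≤
        ; m+n∸m≡n; m+[n∸m]≡n; m+n≤o⇒m≤o∸n; m≤n+o⇒m∸n≤o; module ≤-Reasoning )
open import Data.Nat.Tactic.RingSolver using (solve-∀)
open import Data.Integer as ℤ using (ℤ; 0ℤ; 1ℤ)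
import Data.Integer.Properties as ℤP
open import Algebra.Properties.AbelianGroup ℤP.+-0-abelianGroup using (∙-cancelʳ)
open import Data.Fin using (Fin; zero; suc; inject₁; toℕ; _≟_)
open import Data.Fin.Properties using (any?; toℕ<n)
open import Data.Vec as V using (Vec; []; _∷_; toList)
open import Data.Vec.Properties using (lookup-zipWith; lookup∘tabulate; ∷-injective; ≡-dec)
open import Data.List as L using (List; []; _∷_; _++_; length; concat; filter; tabulate)
open import Data.List.Properties using (length-++; length-++-sucʳ; length-tabulate; filter-none; ++-identityʳ)
open import Data.List.Relation.Unary.All as All using (All; []; _∷_)
open import Data.List.Relation.Unary.All.Properties using (all-filter)
open import Data.List.Relation.Unary.Any as Any using (Any; here; there)
open import Data.List.Relation.Unary.Unique.Propositional using (Unique; []; _∷_)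
import Data.List.Relation.Unary.Unique.Propositional.Properties as Unique
open import Data.List.Membership.Propositional using (_∈_; _∉_)
open import Data.List.Membership.Propositional.Properties
  using (∈-∃++; ∈-++⁻; ∈-++⁺ˡ; ∈-++⁺ʳ; ∈-filter⁻; ∈-filter⁺; ∈-tabulate⁻)
open import Data.List.Relation.Binary.Subset.Propositional using (_⊆_)
open import Data.List.Relation.Binary.Permutation.Propositional using (_↭_; prep; ↭-refl; ↭-trans; ↭-reflexive)
open import Data.List.Relation.Binary.Permutation.Propositional.Properties using (shift; ++⁺ˡ; ↭-length)
open import Data.Product using (_×_; Σ; _,_)
open import Data.Sum using (_⊎_; inj₁; inj₂)
open import Data.Bool using (if_then_else_)
open import Function using (_∘_)
open import Level using (0ℓ)
open import Relation.Nullary using (¬_; Dec; yes; no; contradiction)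
open import Relation.Nullary.Decidable using (⌊_⌋)
open import Relation.Unary using (Pred; Decidable)
open import Relation.Unary.Properties using (∁?)
open import Relation.Binary.Definitions using (DecidableEquality)
open import Relation.Binary.PropositionalEquality

module _ {A : Set} where

  ⊆⇒length≤ : {xs ys : List A} → Unique xs → xs ⊆ ys → length xs ≤ length ys
  ⊆⇒length≤ {[]} _ _ = z≤n
  ⊆⇒length≤ {a ∷ xs} (a∉xs ∷ xs!) xs⊆ys with ∈-∃++ (xs⊆ys (here refl))
  ... | P , Q , refl = ≤-trans (s≤s (⊆⇒length≤ xs! xs⊆P++Q)) (≤-reflexive (sym (length-++-sucʳ P a Q)))
    where
    xs⊆P++Q : xs ⊆ P ++ Q
    xs⊆P++Q {y} y∈xs with ∈-++⁻ P (xs⊆ys (there y∈xs))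
    ... | inj₁ y∈P = ∈-++⁺ˡ y∈P
    ... | inj₂ (here refl) = contradiction refl (All.lookup a∉xs y∈xs)
    ... | inj₂ (there y∈Q) = ∈-++⁺ʳ P y∈Q

  Unique∧allEqual⇒length≤1 : {xs : List A} → Unique xs → (∀ {a b} → a ∈ xs → b ∈ xs → a ≡ b) →
                             length xs ≤ 1
  Unique∧allEqual⇒length≤1 {[]} _ _ = z≤n
  Unique∧allEqual⇒length≤1 {_ ∷ []} _ _ = ≤-refl
  Unique∧allEqual⇒length≤1 {_ ∷ _ ∷ _} ((a≢b ∷ _) ∷ _) allEqual =
    contradiction (allEqual (here refl) (there (here refl))) a≢b

  module _ {P : Pred A 0ℓ} (P? : Decidable P) where

    filter-partition-↭ : (xs : List A) → filter P? xs ++ filter (∁? P?) xs ↭ xs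
    filter-partition-↭ [] = ↭-refl
    filter-partition-↭ (x ∷ xs) with P? x
    ... | yes _ = prep x (filter-partition-↭ xs)
    ... | no _ = ↭-trans (shift x (filter P? xs) (filter (∁? P?) xs)) (prep x (filter-partition-↭ xs))

    length-filter-partition : (xs : List A) →
                              length (filter P? xs) + length (filter (∁? P?) xs) ≡ length xs
    length-filter-partition xs =
      trans (sym (length-++ (filter P? xs))) (↭-length (filter-partition-↭ xs))

sumTo : (ℕ → ℕ) → ℕ → ℕ
sumTo b zero = 0
sumTo b (suc n) = b 0 + sumTo (b ∘ suc) n

sumTo-mono-≤ : (b : ℕ → ℕ) {m n : ℕ} → m ≤ n → sumTo b m ≤ sumTo b n
sumTo-mono-≤ b z≤n = z≤n
sumTo-mono-≤ b (s≤s m≤n) = +-monoʳ-≤ (b 0) (sumTo-mono-≤ (b ∘ suc) m≤n)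

sumTo-*ˡ : (d : ℕ) (b : ℕ → ℕ) (n : ℕ) → sumTo (λ j → d * b j) n ≡ d * sumTo b n
sumTo-*ˡ d b zero = sym (*-zeroʳ d)
sumTo-*ˡ d b (suc n) =
  trans (cong ((d * b 0) +_) (sumTo-*ˡ d (b ∘ suc) n)) (sym (*-distribˡ-+ d (b 0) _))

*≤sumTo : {c : ℕ} (b : ℕ → ℕ) (n : ℕ) → (∀ j → j < n → c ≤ b j) → n * c ≤ sumTo b n
*≤sumTo b zero _ = z≤n
*≤sumTo b (suc n) c≤b = +-mono-≤ (c≤b 0 z<s) (*≤sumTo (b ∘ suc) n (λ j j<n → c≤b (suc j) (s≤s j<n)))

sumTo-≤-length-concat : {A : Set} {n : ℕ} (b : ℕ → ℕ) (Ps : Vec (List A) (suc n)) →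
                        (∀ (i : Fin n) → b (toℕ i) ≤ length (V.lookup Ps (inject₁ i))) →
                        sumTo b n ≤ length (concat (toList Ps))
sumTo-≤-length-concat {n = zero} b Ps _ = z≤n
sumTo-≤-length-concat {n = suc n} b (P ∷ Ps) b≤ = begin
  b 0 + sumTo (b ∘ suc) n
    ≤⟨ +-mono-≤ (b≤ zero) (sumTo-≤-length-concat (b ∘ suc) Ps (b≤ ∘ suc)) ⟩
  length P + length (concat (toList Ps))
    ≡⟨ length-++ P ⟨
  length (concat (toList (P ∷ Ps))) ∎
  where open ≤-Reasoning

square<4*[1+j]*j : ∀ j → 1 ≤ j + j → (j + j) * (j + j) < 4 * (suc j * j)
square<4*[1+j]*j zero ()
square<4*[1+j]*j (suc k) _ = subst ((j + j) * (j + j) <_) (sym (identity (suc k))) (m<m+n _ z<s)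
  where
  j = suc k
  identity : ∀ j → 4 * (suc j * j) ≡ (j + j) * (j + j) + 4 * j
  identity = solve-∀

square<4*[1+j]*[1+j] : ∀ j → (j + suc j) * (j + suc j) < 4 * (suc j * suc j)
square<4*[1+j]*[1+j] j = subst ((j + suc j) * (j + suc j) <_) (sym (identity j)) (m<m+n _ z<s)
  where
  identity : ∀ j → 4 * (suc j * suc j) ≡ (j + suc j) * (j + suc j) + suc (suc (suc (4 * j)))
  identity = solve-∀

between-doubles : ∀ j s → 2 * j ≤ s → s < 2 * suc j → s ≡ j + j ⊎ s ≡ j + suc j
between-doubles j s 2j≤s s<2[1+j] with m≤n⇒m<n∨m≡n 2j≤s
... | inj₂ 2j≡s = inj₁ (trans (sym 2j≡s) (double j))
  where
  double : ∀ j → 2 * j ≡ j + j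
  double = solve-∀
... | inj₁ 2j<s = inj₂ (trans (≤-antisym s≤1+2j 2j<s) (double+1 j))
  where
  s≤1+2j : s ≤ suc (2 * j)
  s≤1+2j = s≤s⁻¹ (subst (s <_) (*-suc 2 j) s<2[1+j])
  double+1 : ∀ j → suc (2 * j) ≡ j + suc j
  double+1 = solve-∀

staircase⇒2j≤s : ∀ {s r} → 1 ≤ s → 4 * sumTo (s ∸_) r ≤ s * s → ∀ j → j < r → 2 * j ≤ s
staircase⇒2j≤s _ _ zero _ = z≤n
staircase⇒2j≤s {s} {r} 1≤s small (suc j) 1+j<r with 2 * suc j ≤? s
... | yes fits = fits
... | no ¬fits = contradiction (≤-trans (*-monoʳ-≤ 4 prefix) small) (<⇒≱ square<)
  where
  2j≤s : 2 * j ≤ s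
  2j≤s = staircase⇒2j≤s 1≤s small j (<-trans (n<1+n j) 1+j<r)
  prefix : suc j * (s ∸ j) ≤ sumTo (s ∸_) r
  prefix = ≤-trans (*≤sumTo (s ∸_) (suc j) (λ k k<1+j → ∸-monoʳ-≤ s (s≤s⁻¹ k<1+j)))
                   (sumTo-mono-≤ (s ∸_) (<⇒≤ 1+j<r))
  square< : s * s < 4 * (suc j * (s ∸ j))
  square< with between-doubles j s 2j≤s (≰⇒> ¬fits)
  ... | inj₁ refl rewrite m+n∸m≡n j j = square<4*[1+j]*j j 1≤s
  ... | inj₂ refl rewrite m+n∸m≡n j (suc j) = square<4*[1+j]*[1+j] j

s≤2*[s∸j] : ∀ s j → 2 * j ≤ s → s ≤ 2 * (s ∸ j)
s≤2*[s∸j] s j 2j≤s = begin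
  s                    ≡⟨ m+[n∸m]≡n j≤s ⟨
  j + (s ∸ j)          ≤⟨ +-monoˡ-≤ (s ∸ j) (m+n≤o⇒m≤o∸n j j+j≤s) ⟩
  (s ∸ j) + (s ∸ j)    ≡⟨ cong ((s ∸ j) +_) (+-identityʳ (s ∸ j)) ⟨
  2 * (s ∸ j)          ∎
  where
  open ≤-Reasoning
  j+j≤s : j + j ≤ s
  j+j≤s = subst (_≤ s) (cong (j +_) (+-identityʳ j)) 2j≤s
  j≤s : j ≤ s
  j≤s = ≤-trans (m≤m+n j j) j+j≤s

i+1≰i : (i : ℤ) → ¬ (i ℤ.+ 1ℤ ℤ.≤ i)
i+1≰i i i+1≤i = ℤP.<-irrefl refl (ℤP.suc[i]≤j⇒i<j (subst (ℤ._≤ i) (ℤP.+-comm i 1ℤ) i+1≤i))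

+ᵥ-cancelʳ : ∀ {n} (x y z : Vec ℤ n) → x +ᵥ y ≡ z +ᵥ y → x ≡ z
+ᵥ-cancelʳ [] [] [] _ = refl
+ᵥ-cancelʳ (a ∷ x) (b ∷ y) (c ∷ z) eq with ∷-injective eq
... | a+b≡c+b , eq′ = cong₂ _∷_ (∙-cancelʳ b a c a+b≡c+b) (+ᵥ-cancelʳ x y z eq′)

module _ {s : ℕ} where

  lookup-+ᵥ-unit : (x : Point s) (i m : Fin s) →
                   V.lookup (x +ᵥ unit i) m ≡ V.lookup x m ℤ.+ (if ⌊ i ≟ m ⌋ then 1ℤ else 0ℤ)
  lookup-+ᵥ-unit x i m =
    trans (lookup-zipWith ℤ._+_ m x (unit i)) (cong (ℤ._+_ (V.lookup x m)) (lookup∘tabulate _ m))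

  lookup-+ᵥ-unit-≡ : (x : Point s) (i : Fin s) → V.lookup (x +ᵥ unit i) i ≡ V.lookup x i ℤ.+ 1ℤ
  lookup-+ᵥ-unit-≡ x i rewrite lookup-+ᵥ-unit x i i with i ≟ i
  ... | yes _ = refl
  ... | no i≢i = contradiction refl i≢i

  lookup-+ᵥ-unit-≢ : (x : Point s) {i m : Fin s} → i ≢ m → V.lookup (x +ᵥ unit i) m ≡ V.lookup x m
  lookup-+ᵥ-unit-≢ x {i} {m} i≢m rewrite lookup-+ᵥ-unit x i m with i ≟ m
  ... | yes i≡m = contradiction i≡m i≢m
  ... | no _ = ℤP.+-identityʳ (V.lookup x m)

  lookup-≤-+ᵥ-unit : (x : Point s) (i m : Fin s) → V.lookup x m ℤ.≤ V.lookup (x +ᵥ unit i) m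
  lookup-≤-+ᵥ-unit x i m with i ≟ m
  ... | yes refl = subst (V.lookup x i ℤ.≤_) (sym (lookup-+ᵥ-unit-≡ x i)) (ℤP.i≤i+j _ 1ℤ)
  ... | no i≢m = ℤP.≤-reflexive (sym (lookup-+ᵥ-unit-≢ x i≢m))

  lookup-+ᵥ-unit-shift : {x z : Point s} {i k : Fin s} → k ≢ i → x +ᵥ unit i ≡ z +ᵥ unit k →
                         V.lookup z i ≡ V.lookup x i ℤ.+ 1ℤ
  lookup-+ᵥ-unit-shift {x} {z} {i} {k} k≢i eq = begin
    V.lookup z i              ≡⟨ lookup-+ᵥ-unit-≢ z k≢i ⟨
    V.lookup (z +ᵥ unit k) i  ≡⟨ cong (λ v → V.lookup v i) eq ⟨
    V.lookup (x +ᵥ unit i) i  ≡⟨ lookup-+ᵥ-unit-≡ x i ⟩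
    V.lookup x i ℤ.+ 1ℤ      ∎
    where open ≡-Reasoning

  +ᵥ-unit-injective : (x : Point s) {i k : Fin s} → x +ᵥ unit i ≡ x +ᵥ unit k → i ≡ k
  +ᵥ-unit-injective x {i} {k} eq with k ≟ i
  ... | yes k≡i = sym k≡i
  ... | no k≢i =
    contradiction (ℤP.≤-reflexive (sym (lookup-+ᵥ-unit-shift k≢i eq))) (i+1≰i (V.lookup x i))

  -- From a = x + eᵢ = z + eⱼ we get i ≢ j and zᵢ = xᵢ + 1; then b = x + eₖ = z + eₗ
  -- with k ≢ i would give xᵢ = bᵢ ≥ zᵢ.
  𝒪-∩-subsingleton : {x z a b : Point s} → x ≢ z → a ∈𝒪 x → a ∈𝒪 z → b ∈𝒪 x → b ∈𝒪 z → a ≡ b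
  𝒪-∩-subsingleton {x} {z} x≢z (i , refl) (j , eq₁) (k , refl) (l , eq₂) with j ≟ i
  ... | yes refl = contradiction (+ᵥ-cancelʳ x (unit j) z eq₁) x≢z
  ... | no j≢i with k ≟ i
  ...   | yes refl = refl
  ...   | no k≢i = contradiction x+1≤x (i+1≰i (V.lookup x i))
    where
    x+1≤x : V.lookup x i ℤ.+ 1ℤ ℤ.≤ V.lookup x i
    x+1≤x = begin
      V.lookup x i ℤ.+ 1ℤ      ≡⟨ lookup-+ᵥ-unit-shift j≢i eq₁ ⟨
      V.lookup z i              ≤⟨ lookup-≤-+ᵥ-unit z l i ⟩
      V.lookup (z +ᵥ unit l) i  ≡⟨ cong (λ v → V.lookup v i) eq₂ ⟨
      V.lookup (x +ᵥ unit k) i  ≡⟨ lookup-+ᵥ-unit-≢ x k≢i ⟩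
      V.lookup x i              ∎
      where open ℤP.≤-Reasoning

  _≟ₚ_ : DecidableEquality (Point s)
  _≟ₚ_ = ≡-dec ℤ._≟_

  _∈𝒪?_ : (y x : Point s) → Dec (y ∈𝒪 x)
  y ∈𝒪? x = any? (λ i → y ≟ₚ (x +ᵥ unit i))

  𝒪-list : Point s → List (Point s)
  𝒪-list x = tabulate (λ i → x +ᵥ unit i)

  𝒪-list-unique : (x : Point s) → Unique (𝒪-list x)
  𝒪-list-unique x = Unique.tabulate⁺ (+ᵥ-unit-injective x)

  length-𝒪-list : (x : Point s) → length (𝒪-list x) ≡ s
  length-𝒪-list x = length-tabulate _

  _∈⋃𝒪_ : Point s → List (Point s) → Set
  y ∈⋃𝒪 R = Any (y ∈𝒪_) R

  _∈⋃𝒪?_ : (y : Point s) (R : List (Point s)) → Dec (y ∈⋃𝒪 R)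
  y ∈⋃𝒪? R = Any.any? (y ∈𝒪?_) R

  length-𝒪∩𝒪 : {x z : Point s} → x ≢ z → length (filter (_∈𝒪? z) (𝒪-list x)) ≤ 1
  length-𝒪∩𝒪 {x} {z} x≢z = Unique∧allEqual⇒length≤1 (Unique.filter⁺ _ (𝒪-list-unique x)) shared
    where
    shared : ∀ {a b} → a ∈ filter (_∈𝒪? z) (𝒪-list x) → b ∈ filter (_∈𝒪? z) (𝒪-list x) → a ≡ b
    shared a∈ b∈ with ∈-filter⁻ (_∈𝒪? z) {xs = 𝒪-list x} a∈ | ∈-filter⁻ (_∈𝒪? z) {xs = 𝒪-list x} b∈
    ... | a∈𝒪x , a∈𝒪z | b∈𝒪x , b∈𝒪z =
      𝒪-∩-subsingleton x≢z (∈-tabulate⁻ a∈𝒪x) a∈𝒪z (∈-tabulate⁻ b∈𝒪x) b∈𝒪z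

  length-𝒪∩⋃𝒪 : {x : Point s} (R : List (Point s)) → x ∉ R →
                length (filter (_∈⋃𝒪? R) (𝒪-list x)) ≤ length R
  length-𝒪∩⋃𝒪 {x} [] _ =
    ≤-reflexive (cong length (filter-none (_∈⋃𝒪? []) (All.universal (λ _ ()) (𝒪-list x))))
  length-𝒪∩⋃𝒪 {x} (z ∷ R) x∉z∷R = begin
    length (filter (_∈⋃𝒪? (z ∷ R)) (𝒪-list x))
      ≤⟨ ⊆⇒length≤ (Unique.filter⁺ _ (𝒪-list-unique x)) split ⟩
    length (filter (_∈𝒪? z) (𝒪-list x) ++ filter (_∈⋃𝒪? R) (𝒪-list x))
      ≡⟨ length-++ (filter (_∈𝒪? z) (𝒪-list x)) ⟩
    length (filter (_∈𝒪? z) (𝒪-list x)) + length (filter (_∈⋃𝒪? R) (𝒪-list x))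
      ≤⟨ +-mono-≤ (length-𝒪∩𝒪 (x∉z∷R ∘ here)) (length-𝒪∩⋃𝒪 R (x∉z∷R ∘ there)) ⟩
    suc (length R) ∎
    where
    open ≤-Reasoning
    split : filter (_∈⋃𝒪? (z ∷ R)) (𝒪-list x) ⊆ filter (_∈𝒪? z) (𝒪-list x) ++ filter (_∈⋃𝒪? R) (𝒪-list x)
    split y∈ with ∈-filter⁻ (_∈⋃𝒪? (z ∷ R)) {xs = 𝒪-list x} y∈
    ... | y∈𝒪x , here y∈𝒪z = ∈-++⁺ˡ (∈-filter⁺ (_∈𝒪? z) y∈𝒪x y∈𝒪z)
    ... | y∈𝒪x , there y∈⋃𝒪R = ∈-++⁺ʳ _ (∈-filter⁺ (_∈⋃𝒪? R) y∈𝒪x y∈⋃𝒪R)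

  greedyParts : (E : List (Point s)) → List (Point s) → Vec (List (Point s)) (suc (length E))
  greedyParts [] G = G ∷ []
  greedyParts (x ∷ E) G = filter (_∈𝒪? x) G ∷ greedyParts E (filter (∁? (_∈𝒪? x)) G)

  greedyParts-↭ : (E G : List (Point s)) → concat (toList (greedyParts E G)) ↭ G
  greedyParts-↭ [] G = ↭-reflexive (++-identityʳ G)
  greedyParts-↭ (x ∷ E) G = ↭-trans (++⁺ˡ _ (greedyParts-↭ E _)) (filter-partition-↭ (_∈𝒪? x) G)

  greedyParts-⊆𝒪 : (E G : List (Point s)) (i : Fin (length E)) →
                   All (_∈𝒪 L.lookup E i) (V.lookup (greedyParts E G) (inject₁ i))
  greedyParts-⊆𝒪 (x ∷ E) G zero = all-filter (_∈𝒪? x) G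
  greedyParts-⊆𝒪 (x ∷ E) G (suc i) = greedyParts-⊆𝒪 E _ i

  -- R lists the points served before those of E, and G is what they left of F.
  greedyParts-length : (E R G : List (Point s)) → Unique E → (∀ {x} → x ∈ E → x ∉ R) →
                       (∀ {x y} → x ∈ E → y ∈𝒪 x → ¬ y ∈⋃𝒪 R → y ∈ G) → (i : Fin (length E)) →
                       s ∸ (length R + toℕ i) ≤ length (V.lookup (greedyParts E G) (inject₁ i))
  greedyParts-length (x ∷ E) R G _ E∩R≡∅ cover zero =
    subst (λ k → s ∸ k ≤ length (filter (_∈𝒪? x) G)) (sym (+-identityʳ (length R)))
      (m≤n+o⇒m∸n≤o s (length R) (begin
        s
          ≡⟨ length-𝒪-list x ⟨
        length (𝒪-list x)
          ≡⟨ length-filter-partition (_∈⋃𝒪? R) (𝒪-list x) ⟨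
        length (filter (_∈⋃𝒪? R) (𝒪-list x)) + length uncovered
          ≤⟨ +-mono-≤ (length-𝒪∩⋃𝒪 R (E∩R≡∅ (here refl))) uncovered≤ ⟩
        length R + length (filter (_∈𝒪? x) G) ∎))
    where
    open ≤-Reasoning
    uncovered = filter (∁? (_∈⋃𝒪? R)) (𝒪-list x)
    uncovered≤ : length uncovered ≤ length (filter (_∈𝒪? x) G)
    uncovered≤ = ⊆⇒length≤ (Unique.filter⁺ _ (𝒪-list-unique x)) λ y∈ →
      let y∈𝒪x , y∉⋃𝒪R = ∈-filter⁻ (∁? (_∈⋃𝒪? R)) {xs = 𝒪-list x} y∈
      in ∈-filter⁺ (_∈𝒪? x) (cover (here refl) (∈-tabulate⁻ y∈𝒪x) y∉⋃𝒪R) (∈-tabulate⁻ y∈𝒪x)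
  greedyParts-length (x ∷ E) R G (x∉E ∷ E!) E∩R≡∅ cover (suc i) =
    subst (λ k → s ∸ k ≤ length (V.lookup (greedyParts E G∖𝒪x) (inject₁ i)))
          (sym (+-suc (length R) (toℕ i)))
      (greedyParts-length E (x ∷ R) G∖𝒪x E! E∩x∷R≡∅ cover′ i)
    where
    G∖𝒪x = filter (∁? (_∈𝒪? x)) G
    E∩x∷R≡∅ : ∀ {x′} → x′ ∈ E → x′ ∉ x ∷ R
    E∩x∷R≡∅ x′∈E (here x′≡x) = All.lookup x∉E x′∈E (sym x′≡x)
    E∩x∷R≡∅ x′∈E (there x′∈R) = E∩R≡∅ (there x′∈E) x′∈R
    cover′ : ∀ {x′ y} → x′ ∈ E → y ∈𝒪 x′ → ¬ y ∈⋃𝒪 (x ∷ R) → y ∈ G∖𝒪x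
    cover′ x′∈E y∈𝒪x′ y∉ = ∈-filter⁺ (∁? (_∈𝒪? x)) (cover (there x′∈E) y∈𝒪x′ (y∉ ∘ there)) (y∉ ∘ here)

proposition6p1 : (s : ℕ) → 1 ≤ s → (E F : List (Point s)) → Unique E → Unique F →
    𝒪⊆ E F → 4 * length F ≤ s * s →
    (s * length E ≤ 2 * length F) ×
    Σ (Vec (List (Point s)) (suc (length E))) (λ Ps →
      (concat (toList Ps) ↭ F) ×
      ((i : Fin (length E)) →
        All (λ y → y ∈𝒪 L.lookup E i) (V.lookup Ps (inject₁ i)) ×
        (s ≤ 2 * length (V.lookup Ps (inject₁ i)))))
proposition6p1 s 1≤s E F E! _ 𝒪E⊆F small =
  s*|E|≤2*|F| , greedyParts E F , greedyParts-↭ E F , λ i → greedyParts-⊆𝒪 E F i , s≤2*|part| i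
  where
  part-≥ : ∀ i → s ∸ toℕ i ≤ length (V.lookup (greedyParts E F) (inject₁ i))
  part-≥ = greedyParts-length E [] F E! (λ _ ()) λ { {x} x∈E (i , refl) _ → 𝒪E⊆F x x∈E i }
  staircase≤|F| : sumTo (s ∸_) (length E) ≤ length F
  staircase≤|F| = ≤-trans (sumTo-≤-length-concat (s ∸_) (greedyParts E F) part-≥)
                          (≤-reflexive (↭-length (greedyParts-↭ E F)))
  2j≤s : ∀ j → j < length E → 2 * j ≤ s
  2j≤s = staircase⇒2j≤s 1≤s (≤-trans (*-monoʳ-≤ 4 staircase≤|F|) small)
  s≤2*|part| : ∀ i → s ≤ 2 * length (V.lookup (greedyParts E F) (inject₁ i))
  s≤2*|part| i = ≤-trans (s≤2*[s∸j] s (toℕ i) (2j≤s (toℕ i) (toℕ<n i))) (*-monoʳ-≤ 2 (part-≥ i))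
  s*|E|≤2*|F| : s * length E ≤ 2 * length F
  s*|E|≤2*|F| = begin
    s * length E                          ≡⟨ *-comm s (length E) ⟩
    length E * s                          ≤⟨ *≤sumTo _ (length E) (λ j j<|E| → s≤2*[s∸j] s j (2j≤s j j<|E|)) ⟩
    sumTo (λ j → 2 * (s ∸ j)) (length E)  ≡⟨ sumTo-*ˡ 2 (s ∸_) (length E) ⟩
    2 * sumTo (s ∸_) (length E)           ≤⟨ *-monoʳ-≤ 2 staircase≤|F| ⟩
    2 * length F                          ∎
    where open ≤-Reasoning
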